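{- Let $m\geq 3$ and let $\mathbb{P}_m(2)$ be the undirected generalized pancake graph with $n=2$. Then \[ \gamma(\mathbb{P}_m(2))\leq \begin{cases} m^2-3m+1, & \text{if } m \text{ is odd and } 3\mid m,\\ m^2-2m+1, & \text{if } m \text{ is odd and } 3\nmid m,\\ m^2-\tfrac{7}{2}m+1, & \text{if } m \text{ is even and } 3\mid m,\\ m^2-\tfrac{5}{2}m+1, & \text{if } m \text{ is even and } 3\nmid m. \end{cases} \]
   Context: For a graph $G$, $\gamma(G)$ denotes its genus: the minimum genus of a closed orientable surface on which $G$ can be embedded without edge crossings. Let $S(m,2)=C_m\wr S_2$. Its elements are written $\pi_1^{a_1}\pi_2^{a_2}$, where $\pi_1\pi_2$ is a permutation of $\{1,2\}$ and $a_1,a_2\in\{0,\dots,m-1\}$. The flip $r_1$ maps $\pi_1^{a_1}\pi_2^{a_2}$ to $\pi_1^{a_1+1}\pi_2^{a_2}$. The flip $r_2$ maps $\pi_1^{a_1}\pi_2^{a_2}$ to $\pi_2^{a_2+1}\pi_1^{a_1+1}$. Signs are taken modulo $m$. The undirected generalized pancake graph $\mathbb{P}_m(2)$ has vertex set $S(m,2)$. Vertices $v,w$ are adjacent iff $w=r_i(v)$ or $v=r_i(w)$ for some $i\in\{1,2\}$. -}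

module Defs where

open import Data.Nat using (ℕ; zero; suc; _*_; _/_; _%_; NonZero; _<_)
open import Data.Nat.DivMod using (m%n<n)
open import Data.Integer as ℤ using (ℤ; +_)
open import Data.Fin as Fin using (Fin)
open import Data.Bool using (Bool; true; false; not; if_then_else_; _∨_)
open import Data.Bool.Properties as BoolP using ()
open import Data.Fin.Properties as FinP using ()
open import Data.List using (List; []; _∷_; length; filter; upTo; concatMap; allFin)
open import Data.Bool.ListAction using (any)
open import Data.Product using (Σ; _×_; _,_; ∃-syntax)
open import Data.Product.Properties using (≡-dec)
open import Relation.Nullary.Decidable using (⌊_⌋)
open import Relation.Binary using (DecidableEquality)
open import Relation.Binary.PropositionalEquality using (_≡_)

record FinGraph : Set₁ where
  field
    V        : Set
    _≟_      : DecidableEquality V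
    vertices : List V          -- every vertex exactly once
    adj      : V → V → Bool    -- symmetric, irreflexive

iter : {A : Set} → (A → A) → ℕ → A → A
iter f zero    x = x
iter f (suc k) x = f (iter f k x)

module _ (G : FinGraph) where
  open FinGraph G

  Dart : Set
  Dart = V × V

  _≟D_ : DecidableEquality Dart
  _≟D_ = ≡-dec _≟_ _≟_

  darts : List Dart
  darts = concatMap (λ v → concatMap (λ w → if adj v w then (v , w) ∷ [] else []) vertices) vertices

  -- A rotation system: for every vertex v, ρ v is a cyclic permutation of
  -- the neighbourhood of v (ρ v w = successor of w in the rotation at v).
  record Rotation : Set where
    field
      ρ     : V → V → V
      ρ-adj : ∀ v w → adj v w ≡ true → adj v (ρ v w) ≡ true
      ρ-inj : ∀ v w w' → adj v w ≡ true → adj v w' ≡ true → ρ v w ≡ ρ v w' → w ≡ w'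
      ρ-cyc : ∀ v w w' → adj v w ≡ true → adj v w' ≡ true → ∃[ k ] iter (ρ v) k w ≡ w'

  module _ (R : Rotation) where
    open Rotation R

    -- face-tracing permutation on darts (Heffter–Edmonds)
    faceStep : Dart → Dart
    faceStep (v , w) = (w , ρ w v)

    sameFace : Dart → Dart → Bool
    sameFace d e = any (λ k → ⌊ iter faceStep k d ≟D e ⌋) (upTo (suc (length darts)))

    countNew : List Dart → List Dart → ℕ
    countNew seen []       = 0
    countNew seen (d ∷ ds) =
      if any (sameFace d) seen then countNew (d ∷ seen) ds else suc (countNew (d ∷ seen) ds)

    faceCount : ℕ
    faceCount = countNew [] darts

    -- 2·genus of the embedding = 2 − V + E − F (Euler's formula, connected G)
    twiceGenus : ℤ
    twiceGenus = + 2 ℤ.- + length vertices ℤ.+ + (length darts / 2) ℤ.- + faceCount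

  -- γ(G) ≤ b : some orientable (cellular) embedding, i.e. rotation
  -- system, has genus at most b.
  GenusAtMost : ℤ → Set
  GenusAtMost b = Σ Rotation (λ R → twiceGenus R ℤ.≤ + 2 ℤ.* b)

-- The undirected generalized pancake graph P_m(2).
-- A vertex π₁^{a₁} π₂^{a₂} is encoded as (s , a₁ , a₂), where s = false
-- means π₁π₂ = 12 and s = true means π₁π₂ = 21.

module _ (m : ℕ) .{{_ : NonZero m}} where

  inc : Fin m → Fin m
  inc i = Fin.fromℕ< (m%n<n (suc (Fin.toℕ i)) m)

  PV : Set
  PV = Bool × Fin m × Fin m

  r₁ : PV → PV
  r₁ (s , a₁ , a₂) = (s , inc a₁ , a₂)

  -- π₁^{a₁}π₂^{a₂} ↦ π₂^{a₂+1}π₁^{a₁+1}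
  r₂ : PV → PV
  r₂ (s , a₁ , a₂) = (not s , inc a₂ , inc a₁)

  _≟PV_ : DecidableEquality PV
  _≟PV_ = ≡-dec BoolP._≟_ (≡-dec FinP._≟_ FinP._≟_)

  pancakeAdj : PV → PV → Bool
  pancakeAdj v w = ⌊ r₁ v ≟PV w ⌋ ∨ ⌊ r₂ v ≟PV w ⌋ ∨ ⌊ r₁ w ≟PV v ⌋ ∨ ⌊ r₂ w ≟PV v ⌋

  Pancake : FinGraph
  Pancake = record
    { V        = PV
    ; _≟_      = _≟PV_
    ; vertices = concatMap (λ s → concatMap (λ a₁ → Data.List.map (λ a₂ → (s , a₁ , a₂)) (allFin m)) (allFin m)) (false ∷ true ∷ [])
    ; adj      = pancakeAdj
    }

{-# OPTIONS --safe #-}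
module Submission where

-- Give every vertex the rotation r₁, r₁⁻¹, r₂, r₂⁻¹ of its four neighbours. Tracing faces,
-- the darts along r₁⁻¹ close up along the orbits of r₁ (2m faces), the darts along r₂⁻¹ along
-- the orbits of r₂, and the remaining darts alternate r₁, r₂ along the orbits of r₁r₂. With
-- d₂ = gcd(2, m) and d₃ = gcd(3, m), the difference a₁ − a₂ mod m (shifted on the sheet
-- π₁π₂ = 21) together with one coordinate mod d₂, resp. d₃, is constant on these orbits and
-- takes d₂m, resp. d₃m, values. So there are at least (2 + d₂ + d₃)m faces, and Euler's formula
-- with 2m² vertices and 4m² edges gives 2γ ≤ 2 + 2m² − (2 + d₂ + d₃)m: the four cases.

open import Defs
open import Data.Nat using (ℕ; _≤_; _*_; _/_; NonZero)
open import Data.Nat.Divisibility using (_∣_)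
open import Data.Integer as ℤ using (ℤ; +_)
open import Data.Product using (_×_)
open import Relation.Nullary using (¬_)

open import Data.Bool using (Bool; true; false; if_then_else_; T; not; _∨_)
open import Data.Bool.ListAction using (any)
open import Data.Bool.Properties as Bool using (T-≡; not-involutive; not-¬)
open import Data.Empty using (⊥-elim)
open import Data.Fin as Fin using (Fin; toℕ; fromℕ<)
open import Data.Fin.Properties using (toℕ-fromℕ<; toℕ-injective; toℕ<n)
import Data.Integer.Properties as ℤ
open import Data.Integer.Tactic.RingSolver as ℤ-Solver using ()
open import Data.List
  using (List; []; _∷_; _++_; length; map; upTo; concatMap; filterᵇ; allFin; cartesianProduct; cartesianProductWith)
open import Data.List.Properties
  using (length-++; length-++-sucʳ; length-map; length-upTo; length-tabulate; concatMap-cong; map-concatMap; map-∘)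
open import Data.List.Membership.Propositional using (_∈_; find)
open import Data.List.Membership.Propositional.Properties
  using (∈-++⁻; ∈-++⁺ˡ; ∈-++⁺ʳ; ∈-∃++; ∈-insert; ∈-map⁺; ∈-concatMap⁺; ∈-filter⁻; ∈-upTo⁻; ∈-allFin; ∈-cartesianProduct⁺)
open import Data.List.Relation.Binary.Subset.Propositional using (_⊆_)
open import Data.List.Relation.Binary.Subset.Propositional.Properties using (⊆-refl; ⊆-trans; ∈-∷⁺ʳ; ++⁺ʳ; xs⊆x∷xs)
open import Data.List.Relation.Unary.All as All using ([]; _∷_)
open import Data.List.Relation.Unary.Any as Any using (here; there)
open import Data.List.Relation.Unary.Any.Properties using (any⁻; map⁺)
open import Data.List.Relation.Unary.Unique.Propositional using (Unique; []; _∷_)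
open import Data.List.Relation.Unary.Unique.Propositional.Properties using (upTo⁺; filter⁺; allFin⁺; cartesianProduct⁺)
open import Data.Nat.Base using (zero; suc; _+_; _∸_; _<_; _%_; z≤n; s≤s)
open import Data.Nat.DivMod
  using (m%n<n; m%n%n≡m%n; %-distribˡ-+; %-distribˡ-*; %-remove-+ʳ; m<n⇒m%n≡m; m≡m%n+[m/n]*n; m∣n⇒o%n%m≡o%m;
         /-monoˡ-≤; m*n/n≡m; m<n*o⇒m/o<n; m*[n/m]≡n)
open import Data.Nat.Divisibility using (divides; ∣⇒≤; ∣-refl; n∣m*n; 1∣_)
open import Data.Nat.Properties
  using (module ≤-Reasoning; ≤-trans; ≤-reflexive; <⇒≱; ≮⇒≥; _<?_; +-mono-≤; +-comm; +-suc; *-comm; *-suc;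
         +-cancelˡ-≡; m+[n∸m]≡n; m+n∸m≡n; ∸-monoˡ-<)
open import Data.Nat.Tactic.RingSolver using (solve-∀)
open import Data.Product using (_,_; proj₂; ∃-syntax; uncurry)
open import Data.Sum using (_⊎_; inj₁; inj₂)
open import Function using (_∘_; id)
open import Function.Bundles using (Equivalence)
open import Level using (0ℓ)
open import Relation.Binary.Bundles using (Setoid)
open import Relation.Binary.Definitions using (DecidableEquality)
open import Relation.Binary.PropositionalEquality
import Relation.Binary.Reasoning.Setoid as SetoidReasoning
open import Relation.Nullary using (Dec; yes; no)
open import Relation.Nullary.Decidable
  using (does; ⌊_⌋; T?; _⊎-dec_; isYes≗does; dec-true; dec-false; toWitness; fromWitness)
open import Relation.Nullary.Negation using (contradiction)


unique⊆⇒length≤ : {A : Set} {xs ys : List A} → Unique xs → xs ⊆ ys → length xs ≤ length ys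
unique⊆⇒length≤ [] _ = z≤n
unique⊆⇒length≤ {xs = x ∷ xs} (x∉xs ∷ xs!) x∷xs⊆ys with ∈-∃++ (x∷xs⊆ys (here refl))
... | ys₁ , ys₂ , refl = begin
  suc (length xs)            ≤⟨ s≤s (unique⊆⇒length≤ xs! xs⊆ys₁++ys₂) ⟩
  suc (length (ys₁ ++ ys₂))  ≡⟨ length-++-sucʳ ys₁ x ys₂ ⟨
  length (ys₁ ++ x ∷ ys₂)    ∎
  where
  open ≤-Reasoning
  xs⊆ys₁++ys₂ : xs ⊆ ys₁ ++ ys₂
  xs⊆ys₁++ys₂ y∈xs with ∈-++⁻ ys₁ (x∷xs⊆ys (there y∈xs))
  ... | inj₁ y∈ys₁         = ∈-++⁺ˡ y∈ys₁
  ... | inj₂ (here refl)   = ⊥-elim (All.lookup x∉xs y∈xs refl)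
  ... | inj₂ (there y∈ys₂) = ∈-++⁺ʳ ys₁ y∈ys₂

m≤n*o⇒m/o≤n : ∀ {m n o} .{{_ : NonZero o}} → m ≤ n * o → m / o ≤ n
m≤n*o⇒m/o≤n {m} {n} {o} m≤n*o = ≤-trans (/-monoˡ-≤ o m≤n*o) (≤-reflexive (m*n/n≡m n o))

cartesianProductWith≡concatMap : {A B C : Set} (f : A → B → C) (xs : List A) (ys : List B) →
                                 cartesianProductWith f xs ys ≡ concatMap (λ x → map (f x) ys) xs
cartesianProductWith≡concatMap f []       ys = refl
cartesianProductWith≡concatMap f (x ∷ xs) ys = cong (map (f x) ys ++_) (cartesianProductWith≡concatMap f xs ys)

length-cartesianProduct : {A B : Set} (xs : List A) (ys : List B) →
                          length (cartesianProduct xs ys) ≡ length xs * length ys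
length-cartesianProduct []       ys = refl
length-cartesianProduct (x ∷ xs) ys = begin
  length (map (x ,_) ys ++ cartesianProduct xs ys)          ≡⟨ length-++ (map (x ,_) ys) ⟩
  length (map (x ,_) ys) + length (cartesianProduct xs ys)  ≡⟨ cong₂ _+_ (length-map (x ,_) ys) (length-cartesianProduct xs ys) ⟩
  length ys + length xs * length ys                         ∎
  where open ≡-Reasoning

length-concatMap≤ : {A B : Set} (f : A → List B) {d : ℕ} → (∀ x → length (f x) ≤ d) →
                    ∀ xs → length (concatMap f xs) ≤ d * length xs
length-concatMap≤ f {d} f≤ []       = z≤n
length-concatMap≤ f {d} f≤ (x ∷ xs) = begin
  length (f x ++ concatMap f xs)         ≡⟨ length-++ (f x) ⟩
  length (f x) + length (concatMap f xs) ≤⟨ +-mono-≤ (f≤ x) (length-concatMap≤ f f≤ xs) ⟩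
  d + d * length xs                      ≡⟨ *-suc d (length xs) ⟨
  d * suc (length xs)                    ∎
  where open ≤-Reasoning

length-concatMap-if : {A B : Set} (p : A → Bool) (f : A → B) (xs : List A) →
                      length (concatMap (λ x → if p x then f x ∷ [] else []) xs) ≡ length (filterᵇ p xs)
length-concatMap-if p f []       = refl
length-concatMap-if p f (x ∷ xs) with p x
... | true  = cong suc (length-concatMap-if p f xs)
... | false = length-concatMap-if p f xs

∀<-split : {P : ℕ → Set} (a b : ℕ) → (∀ j → j < a → P j) → (∀ j → j < b → P (a + j)) → ∀ j → j < a + b → P j
∀<-split {P} a b below above j j<a+b with j <? a
... | yes j<a = below j j<a
... | no  j≮a = subst P (m+[n∸m]≡n a≤j) (above (j ∸ a) (subst (j ∸ a <_) (m+n∸m≡n a b) (∸-monoˡ-< j<a+b a≤j)))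
  where
  a≤j : a ≤ j
  a≤j = ≮⇒≥ j≮a

iter-commute : {A B : Set} {f : A → A} {g : B → B} (h : A → B) → (∀ x → h (f x) ≡ g (h x)) →
               ∀ j x → h (iter f j x) ≡ iter g j (h x)
iter-commute h comm zero    x = refl
iter-commute {g = g} h comm (suc j) x = trans (comm _) (cong g (iter-commute h comm j x))

iter-+ : {A : Set} (f : A → A) → ∀ i j x → iter f (i + j) x ≡ iter f i (iter f j x)
iter-+ f zero    j x = refl
iter-+ f (suc i) j x = cong f (iter-+ f i j x)

-- Congruence modulo n

-- A record rather than x % n ≡ y % n, so that x and y can be inferred from a proof.
infix 4 _≡_mod_
record _≡_mod_ (x y n : ℕ) .{{_ : NonZero n}} : Set where
  constructor congruent
  field %-≡ : x % n ≡ y % n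
open _≡_mod_ public

module _ {n : ℕ} .{{_ : NonZero n}} where

  refl-mod : ∀ {x} → x ≡ x mod n
  refl-mod = congruent refl

  trans-mod : ∀ {x y z} → x ≡ y mod n → y ≡ z mod n → x ≡ z mod n
  trans-mod (congruent p) (congruent q) = congruent (trans p q)

  ≡⇒≡-mod : ∀ {x y} → x ≡ y → x ≡ y mod n
  ≡⇒≡-mod refl = refl-mod

  ≡-mod-setoid : Setoid 0ℓ 0ℓ
  ≡-mod-setoid = record
    { Carrier       = ℕ
    ; _≈_           = λ x y → x ≡ y mod n
    ; isEquivalence = record { refl = refl-mod ; sym = λ (congruent p) → congruent (sym p) ; trans = trans-mod }
    }

  module ≡-mod-Reasoning = SetoidReasoning ≡-mod-setoid

  +-cong-mod : ∀ {x x' y y'} → x ≡ x' mod n → y ≡ y' mod n → x + y ≡ x' + y' mod n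
  +-cong-mod {x} {x'} {y} {y'} (congruent p) (congruent q) = congruent (begin
    (x + y) % n              ≡⟨ %-distribˡ-+ x y n ⟩
    (x % n + y % n) % n      ≡⟨ cong₂ (λ a b → (a + b) % n) p q ⟩
    (x' % n + y' % n) % n    ≡⟨ %-distribˡ-+ x' y' n ⟨
    (x' + y') % n            ∎)
    where open ≡-Reasoning

  +-congˡ-mod : ∀ x {y y'} → y ≡ y' mod n → x + y ≡ x + y' mod n
  +-congˡ-mod x = +-cong-mod refl-mod

  *-congˡ-mod : ∀ x {y y'} → y ≡ y' mod n → x * y ≡ x * y' mod n
  *-congˡ-mod x {y} {y'} (congruent q) = congruent (begin
    (x * y) % n              ≡⟨ %-distribˡ-* x y n ⟩
    (x % n * (y % n)) % n    ≡⟨ cong (λ b → (x % n * b) % n) q ⟩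
    (x % n * (y' % n)) % n   ≡⟨ %-distribˡ-* x y' n ⟨
    (x * y') % n             ∎)
    where open ≡-Reasoning

  %-≡-mod : ∀ x → x % n ≡ x mod n
  %-≡-mod x = congruent (m%n%n≡m%n x n)

  +-∣-mod : ∀ x {y} → n ∣ y → x + y ≡ x mod n
  +-∣-mod x n∣y = congruent (%-remove-+ʳ x n∣y)

  ≡-mod⇒≡ : ∀ {x y} → x < n → y < n → x ≡ y mod n → x ≡ y
  ≡-mod⇒≡ {x} {y} x<n y<n (congruent p) = trans (sym (m<n⇒m%n≡m x<n)) (trans p (m<n⇒m%n≡m y<n))

  2+x≢x-mod : 2 < n → ∀ {x} → x < n → ¬ (2 + x ≡ x mod n)
  2+x≢x-mod 2<n {x} x<n (congruent p) = <⇒≱ 2<n (∣⇒≤ (divides ((2 + x) / n) (+-cancelˡ-≡ x 2 _ (begin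
    x + 2                           ≡⟨ +-comm x 2 ⟩
    2 + x                           ≡⟨ m≡m%n+[m/n]*n (2 + x) n ⟩
    (2 + x) % n + (2 + x) / n * n   ≡⟨ cong (_+ (2 + x) / n * n) (trans p (m<n⇒m%n≡m x<n)) ⟩
    x + (2 + x) / n * n             ∎))))
    where open ≡-Reasoning

∣-mod : ∀ {d n} .{{_ : NonZero d}} .{{_ : NonZero n}} → d ∣ n → ∀ {x y} → x ≡ y mod n → x ≡ y mod d
∣-mod {d} {n} d∣n {x} {y} (congruent p) =
  congruent (trans (sym (m∣n⇒o%n%m≡o%m d n x d∣n)) (trans (cong (_% d) p) (m∣n⇒o%n%m≡o%m d n y d∣n)))

-- Counting faces

module _ (G : FinGraph) (R : Rotation G) where
  open FinGraph G

  faceRepresentatives : List (Dart G) → List (Dart G) → List (Dart G)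
  faceRepresentatives seen []       = []
  faceRepresentatives seen (d ∷ ds) =
    if any (sameFace G R d) seen
    then faceRepresentatives (d ∷ seen) ds
    else d ∷ faceRepresentatives (d ∷ seen) ds

  length-faceRepresentatives : ∀ seen ds → length (faceRepresentatives seen ds) ≡ countNew G R seen ds
  length-faceRepresentatives seen []       = refl
  length-faceRepresentatives seen (d ∷ ds) with any (sameFace G R d) seen
  ... | true  = length-faceRepresentatives (d ∷ seen) ds
  ... | false = cong suc (length-faceRepresentatives (d ∷ seen) ds)

  module _ (lab : Dart G → ℕ) (lab-faceStep : ∀ d → lab (faceStep G R d) ≡ lab d) where

    lab-iter : ∀ k d → lab (iter (faceStep G R) k d) ≡ lab d
    lab-iter zero    d = refl
    lab-iter (suc k) d = trans (lab-faceStep _) (lab-iter k d)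

    sameFace⇒lab≡ : ∀ {d e} → T (sameFace G R d e) → lab d ≡ lab e
    sameFace⇒lab≡ {d} {e} same
      with k , _ , dₖ≡e ← find (any⁻ (λ k → ⌊ _≟D_ G (iter (faceStep G R) k d) e ⌋) (upTo (suc (length (darts G)))) same) =
      trans (sym (lab-iter k d)) (cong lab (toWitness dₖ≡e))

    labels-covered : ∀ seen ds → map lab ds ⊆ map lab seen ++ map lab (faceRepresentatives seen ds)
    labels-covered seen []       ()
    labels-covered seen (d ∷ ds) with any (sameFace G R d) seen in old
    ... | true  = ∈-∷⁺ʳ lab-d∈ (⊆-trans (labels-covered (d ∷ seen) ds) (∈-∷⁺ʳ lab-d∈ ⊆-refl))
      where
      lab-d∈ : lab d ∈ map lab seen ++ map lab (faceRepresentatives (d ∷ seen) ds)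
      lab-d∈ = ∈-++⁺ˡ (map⁺ (Any.map sameFace⇒lab≡ (any⁻ _ seen (Equivalence.from T-≡ old))))
    ... | false = ∈-∷⁺ʳ (∈-insert (map lab seen))
                    (⊆-trans (labels-covered (d ∷ seen) ds)
                             (∈-∷⁺ʳ (∈-insert (map lab seen)) (++⁺ʳ (map lab seen) (xs⊆x∷xs _ (lab d)))))

    faceCount-≥ : ∀ n → (∀ j → j < n → ∃[ d ] (d ∈ darts G × lab d ≡ j)) → n ≤ faceCount G R
    faceCount-≥ n hit = begin
      n                                 ≡⟨ length-upTo n ⟨
      length (upTo n)                   ≤⟨ unique⊆⇒length≤ (upTo⁺ n) upTo⊆labels ⟩
      length (map lab representatives)  ≡⟨ length-map lab representatives ⟩
      length representatives            ≡⟨ length-faceRepresentatives [] (darts G) ⟩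
      faceCount G R                     ∎
      where
      open ≤-Reasoning
      representatives : List (Dart G)
      representatives = faceRepresentatives [] (darts G)
      upTo⊆labels : upTo n ⊆ map lab representatives
      upTo⊆labels j∈ with d , d∈ , refl ← hit _ (∈-upTo⁻ j∈) = labels-covered [] (darts G) (∈-map⁺ lab d∈)

module _ (G : FinGraph) where
  open FinGraph G

  ∈-darts : ∀ {v w} → v ∈ vertices → w ∈ vertices → adj v w ≡ true → (v , w) ∈ darts G
  ∈-darts {v} {w} v∈ w∈ vw = ∈-concatMap⁺ _ (Any.map (λ { refl → ∈-concatMap⁺ _ (Any.map (λ { refl → vw∈ }) w∈) }) v∈)
    where
    vw∈ : (v , w) ∈ (if adj v w then (v , w) ∷ [] else [])
    vw∈ rewrite vw = here refl

  length-darts≤ : ∀ {d} → (∀ v → length (filterᵇ (adj v) vertices) ≤ d) → length (darts G) ≤ d * length vertices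
  length-darts≤ deg = length-concatMap≤ _ (λ v → subst (_≤ _) (sym (length-concatMap-if (adj v) (v ,_) vertices)) (deg v)) vertices

  genusAtMost-Euler : (R : Rotation G) {q c : ℕ} → length vertices ≡ 2 * q → length (darts G) ≤ 4 * length vertices →
                      2 * c ≤ faceCount G R → GenusAtMost G (+ q ℤ.- + c ℤ.+ + 1)
  genusAtMost-Euler R {q} {c} |V|≡ |D|≤ 2c≤F = R , (begin
    + 2 ℤ.- + length vertices ℤ.+ + (length (darts G) / 2) ℤ.- + faceCount G R
      ≤⟨ ℤ.+-mono-≤ (ℤ.+-monoʳ-≤ (+ 2 ℤ.- + length vertices) (ℤ.+≤+ edges≤)) (ℤ.neg-mono-≤ (ℤ.+≤+ 2c≤F)) ⟩
    + 2 ℤ.- + length vertices ℤ.+ + (4 * q) ℤ.- + (2 * c)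
      ≡⟨ euler ⟩
    + 2 ℤ.* (+ q ℤ.- + c ℤ.+ + 1) ∎)
    where
    open ℤ.≤-Reasoning
    edges≤ : length (darts G) / 2 ≤ 4 * q
    edges≤ = m≤n*o⇒m/o≤n (≤-trans |D|≤ (≤-reflexive (trans (cong (4 *_) |V|≡) (identity q))))
      where
      identity : ∀ q → 4 * (2 * q) ≡ 4 * q * 2
      identity = solve-∀
    euler : + 2 ℤ.- + length vertices ℤ.+ + (4 * q) ℤ.- + (2 * c) ≡ + 2 ℤ.* (+ q ℤ.- + c ℤ.+ + 1)
    euler rewrite |V|≡ | ℤ.pos-* 2 q | ℤ.pos-* 4 q | ℤ.pos-* 2 c = identity (+ q) (+ c)
      where
      identity : ∀ q c → + 2 ℤ.- + 2 ℤ.* q ℤ.+ + 4 ℤ.* q ℤ.- + 2 ℤ.* c ≡ + 2 ℤ.* (q ℤ.- c ℤ.+ + 1)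
      identity = ℤ-Solver.solve-∀

  -- Neighbourhoods indexed by the same moves at every vertex, as in a Cayley graph. Ordering the
  -- moves cyclically by next gives a rotation in which the face through the dart (v , apply X v)
  -- continues with the dart of move next (inverse X) at apply X v (faceStep-apply).
  record Moves : Set₁ where
    field
      Move            : Set
      apply           : Move → V → V
      inverse         : Move → Move
      next            : Move → Move
      apply-inverse   : ∀ X v → apply (inverse X) (apply X v) ≡ v
      apply-injective : ∀ {X Y} v → apply X v ≡ apply Y v → X ≡ Y
      next-injective  : ∀ {X Y} → next X ≡ next Y → X ≡ Y
      next-cycles     : ∀ X Y → ∃[ k ] iter next k X ≡ Y
      adj-apply       : ∀ X v → adj v (apply X v) ≡ true
      adj⇒apply       : ∀ {v w} → adj v w ≡ true → ∃[ X ] w ≡ apply X v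

  module _ (M : Moves) where
    open Moves M

    data Position (v w : V) : Set where
      neighbour : ∀ X → w ≡ apply X v → Position v w
      stranger  : (∀ X → w ≢ apply X v) → Position v w

    position : ∀ v w → Position v w
    position v w with adj v w in vw
    ... | true  = uncurry neighbour (adj⇒apply vw)
    ... | false = stranger λ { X refl → contradiction (trans (sym (adj-apply X v)) vw) λ () }

    stranger-flip : ∀ {v w} → (∀ X → w ≢ apply X v) → (∀ Y → v ≢ apply Y w)
    stranger-flip {v} {w} ¬w Y v≡Yw = ¬w (inverse Y) (sym (trans (cong (apply (inverse Y)) v≡Yw) (apply-inverse Y w)))

    rotateAt : ∀ {v w} → Position v w → V
    rotateAt {v}     (neighbour X _) = apply (next X) v
    rotateAt {w = w} (stranger _)    = w

    rotate : V → V → V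
    rotate v w = rotateAt (position v w)

    rotate-apply : ∀ X v → rotate v (apply X v) ≡ apply (next X) v
    rotate-apply X v with position v (apply X v)
    ... | neighbour Y Xv≡Yv = cong (λ Z → apply (next Z) v) (sym (apply-injective v Xv≡Yv))
    ... | stranger ¬Xv      = contradiction refl (¬Xv X)

    rotate-stranger : ∀ {v w} → (∀ X → w ≢ apply X v) → rotate v w ≡ w
    rotate-stranger {v} {w} ¬w with position v w
    ... | neighbour X w≡Xv = contradiction w≡Xv (¬w X)
    ... | stranger _       = refl

    iter-rotate-apply : ∀ k X v → iter (rotate v) k (apply X v) ≡ apply (iter next k X) v
    iter-rotate-apply k X v = sym (iter-commute (λ Y → apply Y v) (λ Y → sym (rotate-apply Y v)) k X)

    rotation : Rotation G
    rotation = record { ρ = rotate ; ρ-adj = rotate-adj ; ρ-inj = rotate-injective ; ρ-cyc = rotate-cycles }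
      where
      rotate-adj : ∀ v w → adj v w ≡ true → adj v (rotate v w) ≡ true
      rotate-adj v w vw with X , refl ← adj⇒apply vw =
        subst (λ u → adj v u ≡ true) (sym (rotate-apply X v)) (adj-apply (next X) v)

      rotate-injective : ∀ v w w' → adj v w ≡ true → adj v w' ≡ true → rotate v w ≡ rotate v w' → w ≡ w'
      rotate-injective v w w' vw vw' eq with X , refl ← adj⇒apply vw | Y , refl ← adj⇒apply vw' =
        cong (λ Z → apply Z v) (next-injective (apply-injective v (trans (sym (rotate-apply X v)) (trans eq (rotate-apply Y v)))))

      rotate-cycles : ∀ v w w' → adj v w ≡ true → adj v w' ≡ true → ∃[ k ] iter (rotate v) k w ≡ w'
      rotate-cycles v w w' vw vw' with X , refl ← adj⇒apply vw | Y , refl ← adj⇒apply vw' =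
        let k , Xₖ≡Y = next-cycles X Y in k , trans (iter-rotate-apply k X v) (cong (λ Z → apply Z v) Xₖ≡Y)

    faceStep-apply : ∀ X v → faceStep G rotation (v , apply X v) ≡ (apply X v , apply (next (inverse X)) (apply X v))
    faceStep-apply X v = cong (apply X v ,_)
      (trans (cong (rotate (apply X v)) (sym (apply-inverse X v))) (rotate-apply (inverse X) (apply X v)))

    degree≤ : ∀ {moves : List Move} → (∀ X → X ∈ moves) → Unique vertices →
              ∀ v → length (filterᵇ (adj v) vertices) ≤ length moves
    degree≤ {moves} ∈-moves vertices! v = begin
      length (filterᵇ (adj v) vertices)     ≤⟨ unique⊆⇒length≤ (filter⁺ _ vertices!) neighbours ⟩
      length (map (λ X → apply X v) moves)  ≡⟨ length-map _ moves ⟩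
      length moves                          ∎
      where
      open ≤-Reasoning
      neighbours : filterᵇ (adj v) vertices ⊆ map (λ X → apply X v) moves
      neighbours {w} w∈ with X , refl ← adj⇒apply {v} {w} (Equivalence.to T-≡ (proj₂ (∈-filter⁻ (T? ∘ adj v) {xs = vertices} w∈))) =
        ∈-map⁺ _ (∈-moves X)

    module _ (label : Move → V → ℕ) where

      labelAt : ∀ {v w} → Position v w → ℕ
      labelAt {v} (neighbour X _) = label X v
      labelAt     (stranger _)    = 0

      dartLabel : Dart G → ℕ
      dartLabel (v , w) = labelAt (position v w)

      dartLabel-apply : ∀ X v → dartLabel (v , apply X v) ≡ label X v
      dartLabel-apply X v with position v (apply X v)
      ... | neighbour Y Xv≡Yv = cong (λ Z → label Z v) (sym (apply-injective v Xv≡Yv))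
      ... | stranger ¬Xv      = contradiction refl (¬Xv X)

      dartLabel-stranger : ∀ {v w} → (∀ X → w ≢ apply X v) → dartLabel (v , w) ≡ 0
      dartLabel-stranger {v} {w} ¬w with position v w
      ... | neighbour X w≡Xv = contradiction w≡Xv (¬w X)
      ... | stranger _       = refl

      module _ (label-faceStep : ∀ X v → label (next (inverse X)) (apply X v) ≡ label X v) where

        dartLabel-faceStep : ∀ d → dartLabel (faceStep G rotation d) ≡ dartLabel d
        dartLabel-faceStep (v , w) with position v w
        ... | neighbour X refl = begin
          dartLabel (faceStep G rotation (v , apply X v))           ≡⟨ cong dartLabel (faceStep-apply X v) ⟩
          dartLabel (apply X v , apply (next (inverse X)) (apply X v)) ≡⟨ dartLabel-apply (next (inverse X)) (apply X v) ⟩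
          label (next (inverse X)) (apply X v)                      ≡⟨ label-faceStep X v ⟩
          label X v                                                 ∎
          where open ≡-Reasoning
        ... | stranger ¬w = begin
          dartLabel (w , rotate w v)  ≡⟨ cong (λ u → dartLabel (w , u)) (rotate-stranger (stranger-flip ¬w)) ⟩
          dartLabel (w , v)           ≡⟨ dartLabel-stranger (stranger-flip ¬w) ⟩
          0                           ∎
          where open ≡-Reasoning

        rotation-faceCount-≥ : (∀ v → v ∈ vertices) → ∀ n → (∀ j → j < n → ∃[ X ] ∃[ v ] label X v ≡ j) →
                               n ≤ faceCount G rotation
        rotation-faceCount-≥ ∈-vertices n hit = faceCount-≥ G rotation dartLabel dartLabel-faceStep n dart-hit
          where
          dart-hit : ∀ j → j < n → ∃[ d ] (d ∈ darts G × dartLabel d ≡ j)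
          dart-hit j j<n with X , v , refl ← hit j j<n =
            (v , apply X v) , ∈-darts (∈-vertices v) (∈-vertices (apply X v)) (adj-apply X v) , dartLabel-apply X v

-- The pancake graph P_m(2), with m = suc k

module PancakeGraph (k : ℕ) (2≤k : 2 ≤ k) where

  m : ℕ
  m = suc k

  dec : Fin m → Fin m
  dec a = fromℕ< (m%n<n (k + toℕ a) m)

  toℕ-inc : ∀ a → toℕ (inc m a) ≡ suc (toℕ a) mod m
  toℕ-inc a = trans-mod (≡⇒≡-mod (toℕ-fromℕ< _)) (%-≡-mod (suc (toℕ a)))

  toℕ-dec : ∀ a → toℕ (dec a) ≡ k + toℕ a mod m
  toℕ-dec a = trans-mod (≡⇒≡-mod (toℕ-fromℕ< _)) (%-≡-mod (k + toℕ a))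

  toℕ-iter-inc : ∀ j a → toℕ (iter (inc m) j a) ≡ j + toℕ a mod m
  toℕ-iter-inc zero    a = refl-mod
  toℕ-iter-inc (suc j) a = trans-mod (toℕ-inc (iter (inc m) j a)) (+-congˡ-mod 1 (toℕ-iter-inc j a))

  toℕ-mod-injective : ∀ {a b : Fin m} → toℕ a ≡ toℕ b mod m → a ≡ b
  toℕ-mod-injective {a} {b} eq = toℕ-injective (≡-mod⇒≡ (toℕ<n a) (toℕ<n b) eq)

  suc[k+x]≡x+m : ∀ x → suc (k + x) ≡ x + suc k
  suc[k+x]≡x+m x = trans (cong suc (+-comm k x)) (sym (+-suc x k))

  inc-dec : ∀ a → inc m (dec a) ≡ a
  inc-dec a = toℕ-mod-injective (begin
    toℕ (inc m (dec a))   ≈⟨ toℕ-inc (dec a) ⟩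
    suc (toℕ (dec a))     ≈⟨ +-congˡ-mod 1 (toℕ-dec a) ⟩
    suc (k + toℕ a)       ≡⟨ suc[k+x]≡x+m (toℕ a) ⟩
    toℕ a + m             ≈⟨ +-∣-mod (toℕ a) ∣-refl ⟩
    toℕ a                 ∎)
    where open ≡-mod-Reasoning

  dec-inc : ∀ a → dec (inc m a) ≡ a
  dec-inc a = toℕ-mod-injective (begin
    toℕ (dec (inc m a))   ≈⟨ toℕ-dec (inc m a) ⟩
    k + toℕ (inc m a)     ≈⟨ +-congˡ-mod k (toℕ-inc a) ⟩
    k + suc (toℕ a)       ≡⟨ trans (+-suc k (toℕ a)) (suc[k+x]≡x+m (toℕ a)) ⟩
    toℕ a + m             ≈⟨ +-∣-mod (toℕ a) ∣-refl ⟩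
    toℕ a                 ∎)
    where open ≡-mod-Reasoning

  inc≢dec : ∀ a → inc m a ≢ dec a
  inc≢dec a inc≡dec = 2+x≢x-mod (s≤s 2≤k) (toℕ<n a) (begin
    2 + toℕ a                 ≈⟨ +-congˡ-mod 1 (toℕ-inc a) ⟨
    suc (toℕ (inc m a))       ≈⟨ toℕ-inc (inc m a) ⟨
    toℕ (inc m (inc m a))     ≡⟨ cong (toℕ ∘ inc m) inc≡dec ⟩
    toℕ (inc m (dec a))       ≡⟨ cong toℕ (inc-dec a) ⟩
    toℕ a                     ∎)
    where open ≡-mod-Reasoning

  V : Set
  V = PV m

  _≟V_ : DecidableEquality V
  _≟V_ = _≟PV_ m

  r₁⁻¹ r₂⁻¹ : V → V
  r₁⁻¹ (s , a , b) = (s , dec a , b)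
  r₂⁻¹ (s , a , b) = (not s , dec b , dec a)

  data Flip : Set where
    r₁⁺ r₁⁻ r₂⁺ r₂⁻ : Flip

  apply : Flip → V → V
  apply r₁⁺ = r₁ m
  apply r₁⁻ = r₁⁻¹
  apply r₂⁺ = r₂ m
  apply r₂⁻ = r₂⁻¹

  inverse : Flip → Flip
  inverse r₁⁺ = r₁⁻
  inverse r₁⁻ = r₁⁺
  inverse r₂⁺ = r₂⁻
  inverse r₂⁻ = r₂⁺

  apply-inverse : ∀ X v → apply (inverse X) (apply X v) ≡ v
  apply-inverse r₁⁺ (s , a , b) = cong (λ a → s , a , b) (dec-inc a)
  apply-inverse r₁⁻ (s , a , b) = cong (λ a → s , a , b) (inc-dec a)
  apply-inverse r₂⁺ (s , a , b) = cong₂ _,_ (not-involutive s) (cong₂ _,_ (dec-inc a) (dec-inc b))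
  apply-inverse r₂⁻ (s , a , b) = cong₂ _,_ (not-involutive s) (cong₂ _,_ (inc-dec a) (inc-dec b))

  flipBetween : V → V → Flip
  flipBetween (s , a , b) (s' , a' , _) =
    if does (s Bool.≟ s') then (if does (a' Fin.≟ inc m a) then r₁⁺ else r₁⁻)
                          else (if does (a' Fin.≟ inc m b) then r₂⁺ else r₂⁻)

  flipBetween-apply : ∀ X v → flipBetween v (apply X v) ≡ X
  flipBetween-apply r₁⁺ (s , a , b)
    rewrite dec-true (s Bool.≟ s) refl | dec-true (inc m a Fin.≟ inc m a) refl = refl
  flipBetween-apply r₁⁻ (s , a , b)
    rewrite dec-true (s Bool.≟ s) refl | dec-false (dec a Fin.≟ inc m a) (inc≢dec a ∘ sym) = refl
  flipBetween-apply r₂⁺ (s , a , b)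
    rewrite dec-false (s Bool.≟ not s) (not-¬ refl) | dec-true (inc m b Fin.≟ inc m b) refl = refl
  flipBetween-apply r₂⁻ (s , a , b)
    rewrite dec-false (s Bool.≟ not s) (not-¬ refl) | dec-false (dec b Fin.≟ inc m b) (inc≢dec b ∘ sym) = refl

  apply-injective : ∀ {X Y} v → apply X v ≡ apply Y v → X ≡ Y
  apply-injective {X} {Y} v eq = begin
    X                          ≡⟨ flipBetween-apply X v ⟨
    flipBetween v (apply X v)  ≡⟨ cong (flipBetween v) eq ⟩
    flipBetween v (apply Y v)  ≡⟨ flipBetween-apply Y v ⟩
    Y                          ∎
    where open ≡-Reasoning

  next previous : Flip → Flip
  next r₁⁺ = r₁⁻
  next r₁⁻ = r₂⁺
  next r₂⁺ = r₂⁻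
  next r₂⁻ = r₁⁺
  previous r₁⁺ = r₂⁻
  previous r₁⁻ = r₁⁺
  previous r₂⁺ = r₁⁻
  previous r₂⁻ = r₂⁺

  previous-next : ∀ X → previous (next X) ≡ X
  previous-next r₁⁺ = refl
  previous-next r₁⁻ = refl
  previous-next r₂⁺ = refl
  previous-next r₂⁻ = refl

  reaches-r₁⁺ : ∀ X → ∃[ i ] iter next i X ≡ r₁⁺
  reaches-r₁⁺ r₁⁺ = 0 , refl
  reaches-r₁⁺ r₁⁻ = 3 , refl
  reaches-r₁⁺ r₂⁺ = 2 , refl
  reaches-r₁⁺ r₂⁻ = 1 , refl

  r₁⁺-reaches : ∀ Y → ∃[ j ] iter next j r₁⁺ ≡ Y
  r₁⁺-reaches r₁⁺ = 0 , refl
  r₁⁺-reaches r₁⁻ = 1 , refl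
  r₁⁺-reaches r₂⁺ = 2 , refl
  r₁⁺-reaches r₂⁻ = 3 , refl

  next-cycles : ∀ X Y → ∃[ j ] iter next j X ≡ Y
  next-cycles X Y with i , Xᵢ≡r₁⁺ ← reaches-r₁⁺ X | j , r₁⁺ⱼ≡Y ← r₁⁺-reaches Y =
    j + i , trans (iter-+ next j i X) (trans (cong (iter next j) Xᵢ≡r₁⁺) r₁⁺ⱼ≡Y)

  adjacent? : ∀ v w → Dec (r₁ m v ≡ w ⊎ r₂ m v ≡ w ⊎ r₁ m w ≡ v ⊎ r₂ m w ≡ v)
  adjacent? v w = (r₁ m v ≟V w) ⊎-dec (r₂ m v ≟V w) ⊎-dec (r₁ m w ≟V v) ⊎-dec (r₂ m w ≟V v)

  pancakeAdj≡⌊adjacent?⌋ : ∀ v w → pancakeAdj m v w ≡ ⌊ adjacent? v w ⌋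
  pancakeAdj≡⌊adjacent?⌋ v w = trans
    (cong₂ _∨_ (isYes≗does (r₁ m v ≟V w)) (cong₂ _∨_ (isYes≗does (r₂ m v ≟V w))
      (cong₂ _∨_ (isYes≗does (r₁ m w ≟V v)) (isYes≗does (r₂ m w ≟V v)))))
    (sym (isYes≗does (adjacent? v w)))

  adj-apply : ∀ X v → pancakeAdj m v (apply X v) ≡ true
  adj-apply X v = trans (pancakeAdj≡⌊adjacent?⌋ v (apply X v)) (Equivalence.to T-≡ (fromWitness {a? = adjacent? v (apply X v)} (witness X)))
    where
    witness : ∀ X → r₁ m v ≡ apply X v ⊎ r₂ m v ≡ apply X v ⊎ r₁ m (apply X v) ≡ v ⊎ r₂ m (apply X v) ≡ v
    witness r₁⁺ = inj₁ refl
    witness r₂⁺ = inj₂ (inj₁ refl)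
    witness r₁⁻ = inj₂ (inj₂ (inj₁ (apply-inverse r₁⁻ v)))
    witness r₂⁻ = inj₂ (inj₂ (inj₂ (apply-inverse r₂⁻ v)))

  adj⇒apply : ∀ {v w} → pancakeAdj m v w ≡ true → ∃[ X ] w ≡ apply X v
  adj⇒apply {v} {w} vw with toWitness {a? = adjacent? v w} (Equivalence.from T-≡ (trans (sym (pancakeAdj≡⌊adjacent?⌋ v w)) vw))
  ... | inj₁ r₁v≡w               = r₁⁺ , sym r₁v≡w
  ... | inj₂ (inj₁ r₂v≡w)        = r₂⁺ , sym r₂v≡w
  ... | inj₂ (inj₂ (inj₁ r₁w≡v)) = r₁⁻ , trans (sym (apply-inverse r₁⁺ w)) (cong r₁⁻¹ r₁w≡v)
  ... | inj₂ (inj₂ (inj₂ r₂w≡v)) = r₂⁻ , trans (sym (apply-inverse r₂⁺ w)) (cong r₂⁻¹ r₂w≡v)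

  pancakeMoves : Moves (Pancake m)
  pancakeMoves = record
    { Move            = Flip
    ; apply           = apply
    ; inverse         = inverse
    ; next            = next
    ; apply-inverse   = apply-inverse
    ; apply-injective = apply-injective
    ; next-injective  = λ {X} {Y} eq → trans (sym (previous-next X)) (trans (cong previous eq) (previous-next Y))
    ; next-cycles     = next-cycles
    ; adj-apply       = adj-apply
    ; adj⇒apply       = adj⇒apply
    }

  flips : List Flip
  flips = r₁⁺ ∷ r₁⁻ ∷ r₂⁺ ∷ r₂⁻ ∷ []

  ∈-flips : ∀ X → X ∈ flips
  ∈-flips r₁⁺ = here refl
  ∈-flips r₁⁻ = there (here refl)
  ∈-flips r₂⁺ = there (there (here refl))
  ∈-flips r₂⁻ = there (there (there (here refl)))

  bools : List Bool
  bools = false ∷ true ∷ []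

  vertices≡ : FinGraph.vertices (Pancake m) ≡ cartesianProduct bools (cartesianProduct (allFin m) (allFin m))
  vertices≡ = sym (begin
    cartesianProduct bools (cartesianProduct (allFin m) (allFin m))
      ≡⟨ cartesianProductWith≡concatMap _,_ bools (cartesianProduct (allFin m) (allFin m)) ⟩
    concatMap (λ s → map (s ,_) (cartesianProduct (allFin m) (allFin m))) bools
      ≡⟨ concatMap-cong (λ s → cong (map (s ,_)) (cartesianProductWith≡concatMap _,_ (allFin m) (allFin m))) bools ⟩
    concatMap (λ s → map (s ,_) (concatMap (λ a → map (a ,_) (allFin m)) (allFin m))) bools
      ≡⟨ concatMap-cong (λ s → map-concatMap (s ,_) (λ a → map (a ,_) (allFin m)) (allFin m)) bools ⟩
    concatMap (λ s → concatMap (λ a → map (s ,_) (map (a ,_) (allFin m))) (allFin m)) bools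
      ≡⟨ concatMap-cong (λ s → concatMap-cong (λ a → sym (map-∘ {g = s ,_} {f = a ,_} (allFin m))) (allFin m)) bools ⟩
    FinGraph.vertices (Pancake m) ∎)
    where open ≡-Reasoning

  ∈-vertices : ∀ v → v ∈ FinGraph.vertices (Pancake m)
  ∈-vertices v@(s , a , b) =
    subst (v ∈_) (sym vertices≡) (∈-cartesianProduct⁺ (∈-Bool s) (∈-cartesianProduct⁺ (∈-allFin a) (∈-allFin b)))
    where
    ∈-Bool : ∀ s → s ∈ bools
    ∈-Bool false = here refl
    ∈-Bool true  = there (here refl)

  vertices-unique : Unique (FinGraph.vertices (Pancake m))
  vertices-unique =
    subst Unique (sym vertices≡) (cartesianProduct⁺ (((λ ()) ∷ []) ∷ [] ∷ []) (cartesianProduct⁺ (allFin⁺ m) (allFin⁺ m)))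

  length-vertices : length (FinGraph.vertices (Pancake m)) ≡ 2 * (m * m)
  length-vertices = begin
    length (FinGraph.vertices (Pancake m))
      ≡⟨ cong length vertices≡ ⟩
    length (cartesianProduct bools (cartesianProduct (allFin m) (allFin m)))
      ≡⟨ length-cartesianProduct bools (cartesianProduct (allFin m) (allFin m)) ⟩
    2 * length (cartesianProduct (allFin m) (allFin m))
      ≡⟨ cong (2 *_) (length-cartesianProduct (allFin m) (allFin m)) ⟩
    2 * (length (allFin m) * length (allFin m))
      ≡⟨ cong (λ n → 2 * (n * n)) (length-tabulate {n = m} id) ⟩
    2 * (m * m) ∎
    where open ≡-Reasoning

  -- twist 0 is r₂ and twist 1 is r₁ ∘ r₂, definitionally.
  twist : ℕ → V → V
  twist c v = iter (r₁ m) c (r₂ m v)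

  iter-r₁ : ∀ c s a b → iter (r₁ m) c (s , a , b) ≡ (s , iter (inc m) c a , b)
  iter-r₁ c s a b = sym (iter-commute (λ a → s , a , b) (λ _ → refl) c a)

  toℕ-iter-inc-inc : ∀ c b → toℕ (iter (inc m) c (inc m b)) ≡ c + suc (toℕ b) mod m
  toℕ-iter-inc-inc c b = trans-mod (toℕ-iter-inc c (inc m b)) (+-congˡ-mod c (toℕ-inc b))

  -- As k ≡ −1 (mod m), twistResidue c is a₁ − a₂ on the sheet false and a₂ − a₁ + c on the
  -- sheet true. Two steps of twist c add 2 + c to both coordinates, whence the phase condition d ∣ 2 + c.
  twistResidue : ℕ → V → ℕ
  twistResidue c (false , a , b) = toℕ a + k * toℕ b
  twistResidue c (true  , a , b) = c + toℕ b + k * toℕ a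

  twistPhase : V → ℕ
  twistPhase (false , a , b) = toℕ b
  twistPhase (true  , a , b) = suc (toℕ a)

  twistLabel : ℕ → (d : ℕ) .{{_ : NonZero d}} → V → ℕ
  twistLabel c d v = twistResidue c v % m + m * (twistPhase v % d)

  twistResidue-twist : ∀ c v → twistResidue c (twist c v) ≡ twistResidue c v mod m
  twistResidue-twist c (false , a , b) = begin
    twistResidue c (twist c (false , a , b))
      ≡⟨ cong (twistResidue c) (iter-r₁ c true (inc m b) (inc m a)) ⟩
    c + toℕ (inc m a) + k * toℕ (iter (inc m) c (inc m b))
      ≈⟨ +-cong-mod (+-congˡ-mod c (toℕ-inc a)) (*-congˡ-mod k (toℕ-iter-inc-inc c b)) ⟩
    c + suc (toℕ a) + k * (c + suc (toℕ b))
      ≡⟨ identity (toℕ a) (toℕ b) c k ⟩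
    toℕ a + k * toℕ b + suc c * m
      ≈⟨ +-∣-mod _ (n∣m*n (suc c)) ⟩
    toℕ a + k * toℕ b ∎
    where
    open ≡-mod-Reasoning
    identity : ∀ x y c k → c + suc x + k * (c + suc y) ≡ x + k * y + suc c * suc k
    identity = solve-∀
  twistResidue-twist c (true , a , b) = begin
    twistResidue c (twist c (true , a , b))
      ≡⟨ cong (twistResidue c) (iter-r₁ c false (inc m b) (inc m a)) ⟩
    toℕ (iter (inc m) c (inc m b)) + k * toℕ (inc m a)
      ≈⟨ +-cong-mod (toℕ-iter-inc-inc c b) (*-congˡ-mod k (toℕ-inc a)) ⟩
    c + suc (toℕ b) + k * suc (toℕ a)
      ≡⟨ identity (toℕ a) (toℕ b) c k ⟩
    c + toℕ b + k * toℕ a + m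
      ≈⟨ +-∣-mod _ ∣-refl ⟩
    c + toℕ b + k * toℕ a ∎
    where
    open ≡-mod-Reasoning
    identity : ∀ x y c k → c + suc y + k * suc x ≡ c + y + k * x + suc k
    identity = solve-∀

  twistPhase-twist : ∀ {c d} .{{_ : NonZero d}} → d ∣ m → d ∣ 2 + c → ∀ v → twistPhase (twist c v) ≡ twistPhase v mod d
  twistPhase-twist {c} d∣m d∣2+c (false , a , b) = begin
    twistPhase (twist c (false , a , b))   ≡⟨ cong twistPhase (iter-r₁ c true (inc m b) (inc m a)) ⟩
    suc (toℕ (iter (inc m) c (inc m b)))   ≈⟨ ∣-mod d∣m (+-congˡ-mod 1 (toℕ-iter-inc-inc c b)) ⟩
    suc (c + suc (toℕ b))                  ≡⟨ identity (toℕ b) c ⟩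
    toℕ b + (2 + c)                        ≈⟨ +-∣-mod (toℕ b) d∣2+c ⟩
    toℕ b                                  ∎
    where
    open ≡-mod-Reasoning
    identity : ∀ y c → suc (c + suc y) ≡ y + (2 + c)
    identity = solve-∀
  twistPhase-twist {c} d∣m d∣2+c (true , a , b) = begin
    twistPhase (twist c (true , a , b))    ≡⟨ cong twistPhase (iter-r₁ c false (inc m b) (inc m a)) ⟩
    toℕ (inc m a)                          ≈⟨ ∣-mod d∣m (toℕ-inc a) ⟩
    suc (toℕ a)                            ∎
    where open ≡-mod-Reasoning

  twistLabel-twist : ∀ {c d} .{{_ : NonZero d}} → d ∣ m → d ∣ 2 + c → ∀ v → twistLabel c d (twist c v) ≡ twistLabel c d v
  twistLabel-twist {c} d∣m d∣2+c v =
    cong₂ (λ r p → r + m * p) (%-≡ (twistResidue-twist c v)) (%-≡ (twistPhase-twist d∣m d∣2+c v))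

  twistLabel-surjective : ∀ {d} .{{_ : NonZero d}} → d ∣ m → ∀ c j → j < d * m → ∃[ v ] twistLabel c d v ≡ j
  twistLabel-surjective {d} d∣m c j j<dm = (false , a , b) , (begin
    (toℕ a + k * toℕ b) % m + m * (toℕ b % d)  ≡⟨ cong₂ (λ r p → r + m * p) (%-≡ residue) phase ⟩
    j % m + m * (j / m)                          ≡⟨ cong (λ x → j % m + x) (*-comm m (j / m)) ⟩
    j % m + j / m * m                            ≡⟨ m≡m%n+[m/n]*n j m ⟨
    j                                            ∎)
    where
    open ≡-Reasoning
    p<d : j / m < d
    p<d = m<n*o⇒m/o<n j<dm
    p<m : j / m < m
    p<m = ≤-trans p<d (∣⇒≤ d∣m)
    a b : Fin m
    a = fromℕ< (m%n<n (j % m + j / m) m)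
    b = fromℕ< p<m
    residue : toℕ a + k * toℕ b ≡ j mod m
    residue = ≡-mod-Reasoning.begin
      toℕ a + k * toℕ b                         ≡-mod-Reasoning.≡⟨ cong₂ (λ x y → x + k * y) (toℕ-fromℕ< _) (toℕ-fromℕ< p<m) ⟩
      (j % m + j / m) % m + k * (j / m)         ≡-mod-Reasoning.≈⟨ +-cong-mod (%-≡-mod (j % m + j / m)) (refl-mod {x = k * (j / m)}) ⟩
      j % m + j / m + k * (j / m)               ≡-mod-Reasoning.≡⟨ identity (j % m) (j / m) k ⟩
      j % m + j / m * m                         ≡-mod-Reasoning.≈⟨ +-∣-mod _ (n∣m*n (j / m)) ⟩
      j % m                                     ≡-mod-Reasoning.≈⟨ %-≡-mod j ⟩
      j                                         ≡-mod-Reasoning.∎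
      where
      identity : ∀ t p k → t + p + k * p ≡ t + p * suc k
      identity = solve-∀
    phase : toℕ b % d ≡ j / m
    phase = trans (cong (_% d) (toℕ-fromℕ< p<m)) (m<n⇒m%n≡m p<d)

  module _ {d₂ d₃ : ℕ} .{{_ : NonZero d₂}} .{{_ : NonZero d₃}}
           (d₂∣m : d₂ ∣ m) (d₂∣2 : d₂ ∣ 2) (d₃∣m : d₃ ∣ m) (d₃∣3 : d₃ ∣ 3) where

    faceLabel : Flip → V → ℕ
    faceLabel r₁⁻ (s , _ , b) = (if s then m else 0) + toℕ b
    faceLabel r₂⁻ v           = m + m + twistLabel 0 d₂ v
    faceLabel r₂⁺ v           = m + m + d₂ * m + twistLabel 1 d₃ v
    faceLabel r₁⁺ v           = faceLabel r₂⁺ (r₁ m v)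

    faceLabel-faceStep : ∀ X v → faceLabel (next (inverse X)) (apply X v) ≡ faceLabel X v
    faceLabel-faceStep r₁⁺ v           = refl
    faceLabel-faceStep r₁⁻ (s , a , b) = refl
    faceLabel-faceStep r₂⁺ v           = cong (λ x → m + m + d₂ * m + x) (twistLabel-twist d₃∣m d₃∣3 v)
    faceLabel-faceStep r₂⁻ v           = cong (λ x → m + m + x) (begin
      twistLabel 0 d₂ (r₂⁻¹ v)          ≡⟨ twistLabel-twist d₂∣m d₂∣2 (r₂⁻¹ v) ⟨
      twistLabel 0 d₂ (r₂ m (r₂⁻¹ v))   ≡⟨ cong (twistLabel 0 d₂) (apply-inverse r₂⁻ v) ⟩
      twistLabel 0 d₂ v                 ∎)
      where open ≡-Reasoning

    faceLabel-surjective : ∀ j → j < m + m + d₂ * m + d₃ * m → ∃[ X ] ∃[ v ] faceLabel X v ≡ j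
    faceLabel-surjective = ∀<-split _ (d₃ * m) (∀<-split (m + m) (d₂ * m) (∀<-split m m sheet₀ sheet₁) r₂-orbits) r₁r₂-orbits
      where
      sheet₀ : ∀ j → j < m → ∃[ X ] ∃[ v ] faceLabel X v ≡ j
      sheet₀ j j<m = r₁⁻ , (false , Fin.zero , fromℕ< j<m) , toℕ-fromℕ< j<m
      sheet₁ : ∀ j → j < m → ∃[ X ] ∃[ v ] faceLabel X v ≡ m + j
      sheet₁ j j<m = r₁⁻ , (true , Fin.zero , fromℕ< j<m) , cong (λ x → m + x) (toℕ-fromℕ< j<m)
      r₂-orbits : ∀ j → j < d₂ * m → ∃[ X ] ∃[ v ] faceLabel X v ≡ m + m + j
      r₂-orbits j j< with v , eq ← twistLabel-surjective d₂∣m 0 j j< = r₂⁻ , v , cong (λ x → m + m + x) eq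
      r₁r₂-orbits : ∀ j → j < d₃ * m → ∃[ X ] ∃[ v ] faceLabel X v ≡ m + m + d₂ * m + j
      r₁r₂-orbits j j< with v , eq ← twistLabel-surjective d₃∣m 1 j j< = r₂⁺ , v , cong (λ x → m + m + d₂ * m + x) eq

    genusAtMost-pancake : ∀ c → 2 * c ≡ m + m + d₂ * m + d₃ * m → GenusAtMost (Pancake m) (+ (m * m) ℤ.- + c ℤ.+ + 1)
    genusAtMost-pancake c 2c≡ = genusAtMost-Euler (Pancake m) R {q = m * m} {c = c} length-vertices darts≤ faces≥
      where
      R : Rotation (Pancake m)
      R = rotation (Pancake m) pancakeMoves
      darts≤ : length (darts (Pancake m)) ≤ 4 * length (FinGraph.vertices (Pancake m))
      darts≤ = length-darts≤ (Pancake m) (degree≤ (Pancake m) pancakeMoves ∈-flips vertices-unique)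
      faces≥ : 2 * c ≤ faceCount (Pancake m) R
      faces≥ = subst (_≤ faceCount (Pancake m) R) (sym 2c≡)
        (rotation-faceCount-≥ (Pancake m) pancakeMoves faceLabel faceLabel-faceStep ∈-vertices _ faceLabel-surjective)

mainTheorem6 : (m : ℕ) .{{_ : NonZero m}} → 3 ≤ m →
    ((¬ 2 ∣ m) → 3 ∣ m → GenusAtMost (Pancake m) (+ (m * m) ℤ.- + (3 * m) ℤ.+ + 1))
  × ((¬ 2 ∣ m) → ¬ 3 ∣ m → GenusAtMost (Pancake m) (+ (m * m) ℤ.- + (2 * m) ℤ.+ + 1))
  × (2 ∣ m → 3 ∣ m → GenusAtMost (Pancake m) (+ (m * m) ℤ.- + (7 * (m / 2)) ℤ.+ + 1))
  × (2 ∣ m → ¬ 3 ∣ m → GenusAtMost (Pancake m) (+ (m * m) ℤ.- + (5 * (m / 2)) ℤ.+ + 1))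
-- The odd cases do not use ¬ 2 ∣ m: taking d₂ = 1 is valid for every m.
mainTheorem6 (suc k) (s≤s 2≤k) =
    (λ _ 3∣m   → genusAtMost-pancake (1∣ m) (1∣ 2) 3∣m ∣-refl (3 * m) (6m≡ m))
  , (λ _ _     → genusAtMost-pancake (1∣ m) (1∣ 2) (1∣ m) (1∣ 3) (2 * m) (4m≡ m))
  , (λ 2∣m 3∣m → genusAtMost-pancake 2∣m ∣-refl 3∣m ∣-refl (7 * (m / 2)) (trans (twice-half 2∣m 7) (7m≡ m)))
  , (λ 2∣m _   → genusAtMost-pancake 2∣m ∣-refl (1∣ m) (1∣ 3) (5 * (m / 2)) (trans (twice-half 2∣m 5) (5m≡ m)))
  where
  open PancakeGraph k 2≤k
  twice-half : 2 ∣ m → ∀ c → 2 * (c * (m / 2)) ≡ c * m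
  twice-half 2∣m c = trans (identity c (m / 2)) (cong (c *_) (m*[n/m]≡n 2∣m))
    where
    identity : ∀ c h → 2 * (c * h) ≡ c * (2 * h)
    identity = solve-∀
  6m≡ : ∀ n → 2 * (3 * n) ≡ n + n + 1 * n + 3 * n
  6m≡ = solve-∀
  4m≡ : ∀ n → 2 * (2 * n) ≡ n + n + 1 * n + 1 * n
  4m≡ = solve-∀
  7m≡ : ∀ n → 7 * n ≡ n + n + 2 * n + 3 * n
  7m≡ = solve-∀
  5m≡ : ∀ n → 5 * n ≡ n + n + 2 * n + 1 * n
  5m≡ = solve-∀
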